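{- Let $n\ge s\ge 0$ be integers with $s>n/3$ and let $G\in\mathfrak{E}(n,s)$. Then the fortress $\mathcal{F}_G$ is triangle-free.
   Context: All graphs are finite and simple. For integers $n\ge s\ge 0$, $\mathrm{ex}(n,s)$ is the maximum number of edges in a triangle-free graph on $n$ vertices with independence number at most $s$, and $\mathfrak{E}(n,s)$ is the family of triangle-free graphs $G$ on $n$ vertices with $\alpha(G)\le s$ and exactly $\mathrm{ex}(n,s)$ edges. The fortress $\mathcal{F}_G$ of $G\in\mathfrak{E}(n,s)$ is the graph whose vertices are the independent sets $X\subseteq V(G)$ with $|X|=s$, two such sets being adjacent iff they are disjoint. -}

module Defs where

open import Data.Nat using (ℕ; _+_; _*_; _≤_; _<_)
open import Data.Bool using (Bool; true; false; if_then_else_)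
open import Data.Fin using (Fin; toℕ)
open import Data.Fin.Subset using (Subset; _∈_; _∉_; ∣_∣)
open import Data.List using (List; map; allFin)
open import Data.Nat.ListAction using (sum)
open import Data.Nat using (_<ᵇ_)
open import Data.Bool using (_∧_)
open import Relation.Binary.PropositionalEquality using (_≡_)
open import Data.Product using (_×_)
open import Relation.Nullary using (¬_)

record Graph (n : ℕ) : Set where
  field
    adj   : Fin n → Fin n → Bool
    sym   : ∀ i j → adj i j ≡ adj j i
    irrefl : ∀ i → adj i i ≡ false
open Graph public

edges : ∀ {n} → Graph n → ℕ
edges {n} G = sum (map (λ i → sum (map (λ j →
  if (toℕ i <ᵇ toℕ j) ∧ adj G i j then 1 else 0) (allFin n))) (allFin n))

TriangleFree : ∀ {n} → Graph n → Set
TriangleFree {n} G = ∀ (i j k : Fin n) →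
  ¬ (adj G i j ≡ true × adj G j k ≡ true × adj G i k ≡ true)

Independent : ∀ {n} → Graph n → Subset n → Set
Independent {n} G X = ∀ (i j : Fin n) → i ∈ X → j ∈ X → adj G i j ≡ false

IndepNumAtMost : ∀ {n} → Graph n → ℕ → Set
IndepNumAtMost G s = ∀ X → Independent G X → ∣ X ∣ ≤ s

InExtremal : (n s : ℕ) → Graph n → Set
InExtremal n s G = TriangleFree G × IndepNumAtMost G s ×
  (∀ (H : Graph n) → TriangleFree H → IndepNumAtMost H s → edges H ≤ edges G)

FortressVertex : ∀ {n} → Graph n → ℕ → Subset n → Set
FortressVertex G s X = Independent G X × ∣ X ∣ ≡ s

-- Adjacency in the fortress: disjointness (distinctness is automatic when s ≥ 1;
-- we require it explicitly so the fortress is loopless also for s = 0).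
FortressAdj : ∀ {n} → Subset n → Subset n → Set
FortressAdj {n} X Y = (∀ (i : Fin n) → i ∈ X → i ∉ Y) × ¬ (X ≡ Y)

FortressTriangleFree : ∀ {n} → Graph n → ℕ → Set
FortressTriangleFree {n} G s = ∀ (X Y Z : Subset n) →
  FortressVertex G s X → FortressVertex G s Y → FortressVertex G s Z →
  ¬ (FortressAdj X Y × FortressAdj Y Z × FortressAdj X Z)

-- Three pairwise disjoint s-subsets of an n-set have 3s ≤ n elements in total, so for
-- n < 3s no three vertices of the fortress are pairwise adjacent.
module Submission where

open import Defs
open import Data.Nat using (ℕ; _≤_; _<_; _*_; _+_; suc)
open import Data.Nat.Properties using (+-suc; +-assoc; +-identityʳ; <⇒≱)
open import Data.Fin using (Fin) renaming (zero to fzero; suc to fsuc)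
open import Data.Fin.Subset using (Subset; _∈_; _∉_; ∣_∣; _∪_; inside; outside)
open import Data.Fin.Subset.Properties using (∣p∣≤n; x∈p∪q⁻)
open import Data.Vec using ([]; _∷_; here; there)
open import Data.Sum using ([_,_])
open import Data.Product using (_,_)
open import Relation.Binary.PropositionalEquality
  using (_≡_; refl; cong; cong₂; subst; module ≡-Reasoning)

Disjoint : ∀ {n} → Subset n → Subset n → Set
Disjoint {n} p q = ∀ (i : Fin n) → i ∈ p → i ∉ q

Disjoint-∷⁻ : ∀ {n s t} {p q : Subset n} → Disjoint (s ∷ p) (t ∷ q) → Disjoint p q
Disjoint-∷⁻ d i i∈p i∈q = d (fsuc i) (there i∈p) (there i∈q)

Disjoint-∪ˡ : ∀ {n} {p q r : Subset n} → Disjoint p r → Disjoint q r → Disjoint (p ∪ q) r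
Disjoint-∪ˡ {p = p} {q} p#r q#r i i∈p∪q = [ p#r i , q#r i ] (x∈p∪q⁻ p q i∈p∪q)

∣p∪q∣≡∣p∣+∣q∣ : ∀ {n} (p q : Subset n) → Disjoint p q → ∣ p ∪ q ∣ ≡ ∣ p ∣ + ∣ q ∣
∣p∪q∣≡∣p∣+∣q∣ []            []            _ = refl
∣p∪q∣≡∣p∣+∣q∣ (inside  ∷ p) (inside  ∷ q) d with () ← d fzero here here
∣p∪q∣≡∣p∣+∣q∣ (inside  ∷ p) (outside ∷ q) d = cong suc (∣p∪q∣≡∣p∣+∣q∣ p q (Disjoint-∷⁻ d))
∣p∪q∣≡∣p∣+∣q∣ (outside ∷ p) (inside  ∷ q) d = begin
  suc ∣ p ∪ q ∣       ≡⟨ cong suc (∣p∪q∣≡∣p∣+∣q∣ p q (Disjoint-∷⁻ d)) ⟩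
  suc (∣ p ∣ + ∣ q ∣) ≡⟨ +-suc (∣ p ∣) (∣ q ∣) ⟨
  ∣ p ∣ + suc ∣ q ∣   ∎
  where open ≡-Reasoning
∣p∪q∣≡∣p∣+∣q∣ (outside ∷ p) (outside ∷ q) d = ∣p∪q∣≡∣p∣+∣q∣ p q (Disjoint-∷⁻ d)

pairwiseDisjoint⇒∣p∣+∣q∣+∣r∣≤n : ∀ {n} (p q r : Subset n) →
  Disjoint p q → Disjoint q r → Disjoint p r → ∣ p ∣ + ∣ q ∣ + ∣ r ∣ ≤ n
pairwiseDisjoint⇒∣p∣+∣q∣+∣r∣≤n p q r p#q q#r p#r =
  subst (_≤ _) ∣p∪q∪r∣≡∣p∣+∣q∣+∣r∣ (∣p∣≤n ((p ∪ q) ∪ r))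
  where
  open ≡-Reasoning
  ∣p∪q∪r∣≡∣p∣+∣q∣+∣r∣ : ∣ (p ∪ q) ∪ r ∣ ≡ ∣ p ∣ + ∣ q ∣ + ∣ r ∣
  ∣p∪q∪r∣≡∣p∣+∣q∣+∣r∣ = begin
    ∣ (p ∪ q) ∪ r ∣       ≡⟨ ∣p∪q∣≡∣p∣+∣q∣ (p ∪ q) r (Disjoint-∪ˡ p#r q#r) ⟩
    ∣ p ∪ q ∣ + ∣ r ∣     ≡⟨ cong (_+ ∣ r ∣) (∣p∪q∣≡∣p∣+∣q∣ p q p#q) ⟩
    ∣ p ∣ + ∣ q ∣ + ∣ r ∣ ∎

fact3p1 : (n s : ℕ) → s ≤ n → n < 3 * s → (G : Graph n) →
    InExtremal n s G → FortressTriangleFree G s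
fact3p1 n s _ n<3s G _ X Y Z (_ , ∣X∣≡s) (_ , ∣Y∣≡s) (_ , ∣Z∣≡s) ((X#Y , _) , (Y#Z , _) , (X#Z , _)) =
  <⇒≱ n<3s (subst (_≤ n) sizes≡3s (pairwiseDisjoint⇒∣p∣+∣q∣+∣r∣≤n X Y Z X#Y Y#Z X#Z))
  where
  open ≡-Reasoning
  sizes≡3s : ∣ X ∣ + ∣ Y ∣ + ∣ Z ∣ ≡ 3 * s
  sizes≡3s = begin
    ∣ X ∣ + ∣ Y ∣ + ∣ Z ∣ ≡⟨ cong₂ _+_ (cong₂ _+_ ∣X∣≡s ∣Y∣≡s) ∣Z∣≡s ⟩
    s + s + s             ≡⟨ +-assoc s s s ⟩
    s + (s + s)           ≡⟨ cong (λ k → s + (s + k)) (+-identityʳ s) ⟨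
    3 * s                 ∎
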